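{- Let $n\ge 2$ targets $\mathcal T=\{1,\dots,n\}$ be given with travel times $c(u,v)>0$ ($u\ne v$) satisfying the triangle inequality. Let $\mathcal W=(v_1,\dots,v_{k+1})$ be a closed walk with $k\ge n$ visits. Suppose $1\le a<b\le k+1$ are indices and $d$ a target with $v_a=v_b=d$, $v_l\ne d$ for $a<l<b$, and $\sum_{l=a}^{b-1}c(v_l,v_{l+1})=\mathcal R(\mathcal W)$; put $\mathcal W_b=(v_a,\dots,v_b)$ (a binding subwalk of $\mathcal W$). Let $\mathcal W_b'=(w_1,\dots,w_m)$ be obtained from $\mathcal W_b$ by deleting some of the entries $v_l$ with $a<l<b$, in such a way that (i) for every target $u$ occurring in $\mathcal W_b$, the last occurrence of $u$ in $\mathcal W_b$ (the entry $v_l$, $a\le l\le b$, with $l$ maximal such that $v_l=u$) is not deleted, and (ii) consecutive entries of $\mathcal W_b'$ are distinct (so $w_1=w_m=d$). Let $\bar{\mathcal W}=(v_1,\dots,v_b,w_2,\dots,w_m,v_{b+1},\dots,v_{k+1})$, i.e. $\bar{\mathcal W}=\mathcal S_1\circ\mathcal W_b\circ\mathcal W_b'\circ\mathcal S_2$ where $\mathcal W=\mathcal S_1\circ\mathcal W_b\circ\mathcal S_2$. Then $\bar{\mathcal W}$ is a closed walk and $\mathcal R(\bar{\mathcal W})=\mathcal R(\mathcal W)$.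
   Context: Targets $\mathcal T=\{1,\dots,n\}$, $n\ge 2$; travel times $c(u,v)>0$ for distinct $u,v\in\mathcal T$ (set $c(u,u)=0$), satisfying $c(u,v)+c(v,w)\ge c(u,w)$ for all $u,v,w\in\mathcal T$. For an integer $k\ge n$, a closed walk with $k$ visits is a sequence $\mathcal W=(v_1,\dots,v_{k+1})$ of targets with $v_{k+1}=v_1$, $v_i\ne v_{i+1}$ for $1\le i\le k$, and every target appearing among $v_1,\dots,v_k$. The walk is repeated forever: extend it to the infinite periodic sequence $(v_i)_{i\ge 1}$ with $v_{i+k}=v_i$, where moving from $v_i$ to $v_{i+1}$ takes time $c(v_i,v_{i+1})$. For a target $d$, the revisit time $RT(d,\mathcal W)$ is the maximum, over all pairs of indices $i<j$ with $v_i=v_j=d$ and $v_l\ne d$ for $i<l<j$, of $\sum_{l=i}^{j-1}c(v_l,v_{l+1})$. The revisit time of the walk is $\mathcal R(\mathcal W)=\max_{d\in\mathcal T}RT(d,\mathcal W)$. Concatenation $\circ$ of sequences whose last/first entries agree joins them, identifying the common entry.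
   Formalization: The travel times $c(u,v)$ take values in the rationals. -}

module Defs where

open import Data.Nat using (ℕ; zero; suc; _∸_; _<_; _≤_; _%_)
open import Data.Fin using (Fin; toℕ)
open import Data.Bool using (Bool; true; false)
open import Data.Maybe using (Maybe; just; nothing)
open import Data.List using (List; []; _∷_; length; take; drop; head; last; _++_)
open import Data.List.Membership.Propositional using (_∈_; _∉_)
open import Data.List.Relation.Unary.Linked using (Linked)
open import Data.Vec using (Vec; []; _∷_)
open import Data.Rational using (ℚ; 0ℚ; _+_; _≤_; _<_)
open import Data.Product using (Σ; _×_; ∃)
open import Relation.Binary.PropositionalEquality using (_≡_; _≢_)

-- Travel times on targets Fin n (targets 1..n are Fin n = {0,..,n-1}).
Cost : ℕ → Set
Cost n = Fin n → Fin n → ℚ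

record IsTravelTime {n : ℕ} (c : Cost n) : Set where
  field
    zero-diag : ∀ u → c u u ≡ 0ℚ
    positive  : ∀ u v → u ≢ v → 0ℚ Data.Rational.< c u v
    triangle  : ∀ u v w → c u w Data.Rational.≤ c u v + c v w

Walk : ℕ → Set
Walk n = List (Fin n)

record IsClosedWalk {n : ℕ} (W : Walk n) : Set where
  field
    k       : ℕ
    len     : length W ≡ suc k
    n≤k     : n Data.Nat.≤ k
    closed  : head W ≡ last W
    noStay  : Linked (λ x y → x ≢ y) W
    covers  : ∀ t → t ∈ take k W

-- 0-indexed partial lookup.
at : {A : Set} → List A → ℕ → Maybe A
at [] _ = nothing
at (x ∷ xs) zero = just x
at (x ∷ xs) (suc i) = at xs i

-- The infinite periodic extension (0-indexed): entry i is v_{(i mod k)+1}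
-- where k = length W - 1.  (nothing only in the degenerate case k = 0.)
cyc : {A : Set} → List A → ℕ → Maybe A
cyc W i with length W ∸ 1
... | zero = nothing
... | suc p = at W (i % suc p)

-- travel time between two (defined) entries; junk 0 if undefined
mc : {n : ℕ} → Cost n → Maybe (Fin n) → Maybe (Fin n) → ℚ
mc c (just u) (just v) = c u v
mc c _ _ = 0ℚ

segCost : {n : ℕ} → Cost n → Walk n → ℕ → ℕ → ℚ
segCost c W i zero = 0ℚ
segCost c W i (suc m) = mc c (cyc W i) (cyc W (suc i)) + segCost c W (suc i) m

intervalCost : {n : ℕ} → Cost n → Walk n → ℕ → ℕ → ℚ
intervalCost c W i j = segCost c W i (j ∸ i)

ReturnPair : {n : ℕ} → Walk n → Fin n → ℕ → ℕ → Set
ReturnPair W d i j =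
  i Data.Nat.< j × cyc W i ≡ just d × cyc W j ≡ just d ×
  (∀ l → i Data.Nat.< l → l Data.Nat.< j → cyc W l ≢ just d)

IsRT : {n : ℕ} → Cost n → Walk n → Fin n → ℚ → Set
IsRT c W d r =
  (∃ λ i → ∃ λ j → ReturnPair W d i j × intervalCost c W i j ≡ r) ×
  (∀ i j → ReturnPair W d i j → intervalCost c W i j Data.Rational.≤ r)

IsRevisitTime : {n : ℕ} → Cost n → Walk n → ℚ → Set
IsRevisitTime c W r =
  (∃ λ d → IsRT c W d r) × (∀ d r' → IsRT c W d r' → r' Data.Rational.≤ r)

pathCost : {n : ℕ} → Cost n → Walk n → ℚ
pathCost c [] = 0ℚ
pathCost c (u ∷ []) = 0ℚ
pathCost c (u ∷ v ∷ xs) = c u v + pathCost c (v ∷ xs)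

select : {A : Set} → (xs : List A) → Vec Bool (length xs) → List A
select [] [] = []
select (x ∷ xs) (true ∷ bs) = x ∷ select xs bs
select (x ∷ xs) (false ∷ bs) = select xs bs

module Submission where

-- Write the closed walk as W = P ++ D ++ Q, where D = d ∷ M ++ [d] is the binding
-- subwalk and R = pathCost D = R(W), and W̄ = P ++ d ∷ M ++ D' ++ Q with the shortened
-- copy D' = d ∷ S ++ [d], S = select M keep.  All reasoning about revisit times is
-- done on the periodic sequences s and t of W and W̄ (functions ℕ → Fin n).
--   (1) Every return pair of s costs at most R: the costs of the return pairs of a
--       target have a maximum (they repeat with the period), which is an RT value.
--   (2) Every target occurs in D: otherwise a return pair of it would straddle a whole
--       copy of D plus one step of positive cost, costing more than R.
--   (3) Every position i of t is covered: some w > i has t w = t i and the cost from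
--       i to w is at most R.  Outside D' this is inherited from s through (1) and (2);
--       inside D' we use that D' is a subsequence of D keeping every last occurrence,
--       so by the triangle inequality a stretch of D' costs at most the stretch of D
--       between the corresponding positions.
--   (4) Hence every return pair of t costs at most R, while the copy of D in W̄ is a
--       return pair of d of cost R, so R(W̄) = R; that W̄ is a closed walk is list
--       bookkeeping.

open import Defs
open import Data.Nat using (ℕ; zero; suc; _+_; _∸_; _≤_; _<_; z≤n; s≤s; _%_; _<?_; _≤?_)
open import Data.Nat.Properties
open import Data.Nat.DivMod using ([m+n]%n≡m%n; m<n⇒m%n≡m; n%n≡0; m%n<n)
open import Data.Nat.Tactic.RingSolver using (solve-∀)
open import Data.Fin as F using (Fin; toℕ)
open import Data.Fin.Properties using (toℕ-fromℕ<)
open import Data.Bool using (Bool; true; false)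
open import Data.List using (List; []; _∷_; _++_; length; drop; take; map; head; last)
open import Data.List.Properties using (map-∘; length-++; length-map; ++-assoc)
open import Data.List.Membership.Propositional using (_∈_; _∉_)
open import Data.List.Membership.Propositional.Properties using (∈-++⁻)
open import Data.List.Relation.Unary.Any using (here; there)
open import Data.List.Relation.Unary.Linked using (Linked; [-]; _∷_; [])
open import Data.Vec using (Vec; lookup; []; _∷_)
open import Data.Maybe using (just)
open import Data.Maybe.Properties using (just-injective)
open import Data.Product using (_×_; _,_; ∃; ∃₂; proj₁; proj₂)
open import Data.Sum using (inj₁; inj₂; [_,_]′)
open import Data.Empty using (⊥-elim)
open import Relation.Nullary using (yes; no)
open import Relation.Binary.Definitions using (DecidableEquality)
open import Relation.Binary.PropositionalEquality
open import Data.Rational using (ℚ; 0ℚ) renaming (_+_ to _+q_; _≤_ to _≤q_; _<_ to _<q_; _≤?_ to _≤q?_)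
import Data.Rational.Properties as ℚP

nth : {A : Set} → A → List A → ℕ → A
nth z [] _ = z
nth z (x ∷ xs) zero = x
nth z (x ∷ xs) (suc i) = nth z xs i

at≡nth : ∀ {A : Set} (z : A) xs i → i < length xs → at xs i ≡ just (nth z xs i)
at≡nth z (x ∷ xs) zero _ = refl
at≡nth z (x ∷ xs) (suc i) (s≤s h) = at≡nth z xs i h

nth-default : ∀ {A : Set} (a b : A) xs i → i < length xs → nth a xs i ≡ nth b xs i
nth-default a b (x ∷ xs) zero _ = refl
nth-default a b (x ∷ xs) (suc i) (s≤s h) = nth-default a b xs i h

nth-++ˡ : ∀ {A : Set} (z : A) xs ys i → i < length xs → nth z (xs ++ ys) i ≡ nth z xs i
nth-++ˡ z (x ∷ xs) ys zero _ = refl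
nth-++ˡ z (x ∷ xs) ys (suc i) (s≤s h) = nth-++ˡ z xs ys i h

nth-++ʳ : ∀ {A : Set} (z : A) xs ys i → nth z (xs ++ ys) (length xs + i) ≡ nth z ys i
nth-++ʳ z [] ys i = refl
nth-++ʳ z (x ∷ xs) ys i = nth-++ʳ z xs ys i

nth-map : ∀ {A B : Set} (g : A → B) z xs i → nth (g z) (map g xs) i ≡ g (nth z xs i)
nth-map g z [] i = refl
nth-map g z (x ∷ xs) zero = refl
nth-map g z (x ∷ xs) (suc i) = nth-map g z xs i

last≡nth : ∀ {A : Set} (z : A) x xs → last (x ∷ xs) ≡ just (nth z (x ∷ xs) (length xs))
last≡nth z x [] = refl
last≡nth z x (y ∷ xs) = last≡nth z y xs

∈⇒nth : ∀ {A : Set} (z : A) {u} xs → u ∈ xs → ∃ λ e → e < length xs × nth z xs e ≡ u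
∈⇒nth z (x ∷ xs) (here refl) = 0 , s≤s z≤n , refl
∈⇒nth z (x ∷ xs) (there u∈xs) with ∈⇒nth z xs u∈xs
... | e , e< , eq = suc e , s≤s e< , eq

nth∈ : ∀ {A : Set} (z : A) xs i → i < length xs → nth z xs i ∈ xs
nth∈ z (x ∷ xs) zero _ = here refl
nth∈ z (x ∷ xs) (suc i) (s≤s h) = there (nth∈ z xs i h)

nth∈take : ∀ {A : Set} (z : A) xs k i → i < k → i < length xs → nth z xs i ∈ take k xs
nth∈take z (x ∷ xs) (suc k) zero _ _ = here refl
nth∈take z (x ∷ xs) (suc k) (suc i) (s≤s h) (s≤s h') = there (nth∈take z xs k i h h')

∈take⇒nth : ∀ {A : Set} (z : A) {u} k xs → u ∈ take k xs → ∃ λ e → e < k × nth z xs e ≡ u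
∈take⇒nth z (suc k) (x ∷ xs) (here refl) = 0 , s≤s z≤n , refl
∈take⇒nth z (suc k) (x ∷ xs) (there u∈) with ∈take⇒nth z k xs u∈
... | e , e< , eq = suc e , s≤s e< , eq

lookup≡nth : ∀ {A : Set} (z : A) xs (j : Fin (length xs)) → Data.List.lookup xs j ≡ nth z xs (toℕ j)
lookup≡nth z (x ∷ xs) F.zero = refl
lookup≡nth z (x ∷ xs) (F.suc j) = lookup≡nth z xs j

head-++-∷ : ∀ {A : Set} (xs : List A) y ys zs → head (xs ++ y ∷ ys) ≡ head (xs ++ y ∷ zs)
head-++-∷ [] y ys zs = refl
head-++-∷ (x ∷ xs) y ys zs = refl

last-++-∷ : ∀ {A : Set} (xs : List A) y ys → last (xs ++ y ∷ ys) ≡ last (y ∷ ys)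
last-++-∷ [] y ys = refl
last-++-∷ (x ∷ []) y ys = refl
last-++-∷ (x ∷ x' ∷ xs) y ys = last-++-∷ (x' ∷ xs) y ys

linked-nth : ∀ {A : Set} {R : A → A → Set} (z : A) {xs} → Linked R xs →
             ∀ i → suc i < length xs → R (nth z xs i) (nth z xs (suc i))
linked-nth z (r ∷ _) zero _ = r
linked-nth z (_ ∷ l) (suc i) (s≤s h) = linked-nth z l i h
linked-nth z [-] i (s≤s ())

linked-split : ∀ {A : Set} {R : A → A → Set} xs y ys → Linked R (xs ++ y ∷ ys) →
               Linked R (xs ++ y ∷ []) × Linked R (y ∷ ys)
linked-split [] y ys l = [-] , l
linked-split (x ∷ []) y ys (r ∷ l) = (r ∷ [-]) , l
linked-split (x ∷ x' ∷ xs) y ys (r ∷ l) with linked-split (x' ∷ xs) y ys l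
... | front , back = (r ∷ front) , back

linked-join : ∀ {A : Set} {R : A → A → Set} xs y ys → Linked R (xs ++ y ∷ []) → Linked R (y ∷ ys) →
              Linked R (xs ++ y ∷ ys)
linked-join [] y ys _ l = l
linked-join (x ∷ []) y ys (r ∷ [-]) l = r ∷ l
linked-join (x ∷ x' ∷ xs) y ys (r ∷ front) l = r ∷ linked-join (x' ∷ xs) y ys front l

module Occurrences {A : Set} (_≟_ : DecidableEquality A) (z : A) where
  open import Data.List.Membership.DecPropositional _≟_ using (_∈?_)

  lastOcc : ∀ xs p → p < length xs →
            ∃ λ p0 → p ≤ p0 × p0 < length xs × nth z xs p0 ≡ nth z xs p × nth z xs p ∉ drop (suc p0) xs
  lastOcc (x ∷ xs) zero _ with x ∈? xs
  ... | no x∉ = 0 , ≤-refl , s≤s z≤n , refl , x∉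
  ... | yes x∈ with ∈⇒nth z xs x∈
  ...   | e , e< , eq with lastOcc xs e e<
  ...     | p0 , _ , p0< , same , after = suc p0 , z≤n , s≤s p0< , trans same eq , subst (_∉ drop (suc p0) xs) eq after
  lastOcc (x ∷ xs) (suc p) (s≤s h) with lastOcc xs p h
  ... | p0 , p≤ , p0< , same , after = suc p0 , s≤s p≤ , s≤s p0< , same , after

  ∈after⇒nth : ∀ xs p y {u} → p < length xs → u ∈ drop (suc p) xs ++ y ∷ [] →
               ∃ λ e → suc p ≤ e × e ≤ length xs × nth z (xs ++ y ∷ []) e ≡ u
  ∈after⇒nth (x ∷ xs) zero y _ u∈ with ∈⇒nth z (xs ++ y ∷ []) u∈
  ... | e , e< , eq = suc e , s≤s z≤n , s≤s (≤-pred (subst (e <_) (trans (length-++ xs) (+-comm (length xs) 1)) e<)) , eq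
  ∈after⇒nth (x ∷ xs) (suc p) y (s≤s h) u∈ with ∈after⇒nth xs p y h u∈
  ... | e , p< , ≤len , eq = suc e , s≤s p< , s≤s ≤len , eq

  nth∈after : ∀ xs p e y → suc p ≤ e → e ≤ length xs → nth z (xs ++ y ∷ []) e ∈ drop (suc p) xs ++ y ∷ []
  nth∈after (x ∷ xs) zero (suc e) y _ (s≤s h) =
    nth∈ z (xs ++ y ∷ []) e (subst (e <_) (sym (trans (length-++ xs) (+-comm (length xs) 1))) (s≤s h))
  nth∈after (x ∷ xs) (suc p) (suc e) y (s≤s p<) (s≤s h) = nth∈after xs p e y p< h

∉-++-[] : ∀ {A : Set} {x y : A} xs → x ∉ xs → x ≢ y → x ∉ xs ++ y ∷ []
∉-++-[] xs x∉ x≢y x∈ = [ x∉ , (λ { (here eq) → x≢y eq }) ]′ (∈-++⁻ xs x∈)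

-- keptPos xs bs lists, increasingly, the 1-based positions in xs of the entries kept
-- by bs, followed by the position length xs + 1 of a final sentinel.
keptPos : ∀ {A : Set} (xs : List A) → Vec Bool (length xs) → List ℕ
keptPos [] [] = 1 ∷ []
keptPos (x ∷ xs) (true ∷ bs) = 1 ∷ map suc (keptPos xs bs)
keptPos (x ∷ xs) (false ∷ bs) = map suc (keptPos xs bs)

keptPos-length : ∀ {A : Set} (xs : List A) bs → length (keptPos xs bs) ≡ suc (length (select xs bs))
keptPos-length [] [] = refl
keptPos-length (x ∷ xs) (true ∷ bs) = cong suc (trans (length-map suc (keptPos xs bs)) (keptPos-length xs bs))
keptPos-length (x ∷ xs) (false ∷ bs) = trans (length-map suc (keptPos xs bs)) (keptPos-length xs bs)

keptPos-select : ∀ {A : Set} (d : A) (xs : List A) bs y →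
                 map (nth d (y ∷ xs ++ d ∷ [])) (keptPos xs bs) ≡ select xs bs ++ d ∷ []
keptPos-select d [] [] y = refl
keptPos-select d (x ∷ xs) (true ∷ bs) y = cong (x ∷_) (trans (sym (map-∘ (keptPos xs bs))) (keptPos-select d xs bs x))
keptPos-select d (x ∷ xs) (false ∷ bs) y = trans (sym (map-∘ (keptPos xs bs))) (keptPos-select d xs bs x)

nth-map-suc : ∀ L i → i < length L → nth 0 (map suc L) i ≡ suc (nth 0 L i)
nth-map-suc L i h = trans (nth-default 0 1 (map suc L) i (subst (i <_) (sym (length-map suc L)) h)) (nth-map suc 0 L i)

keptPos-bounds : ∀ {A : Set} (xs : List A) bs r → r < length (keptPos xs bs) →
                 1 ≤ nth 0 (keptPos xs bs) r × nth 0 (keptPos xs bs) r ≤ suc (length xs)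
keptPos-bounds [] [] zero _ = s≤s z≤n , s≤s z≤n
keptPos-bounds [] [] (suc r) (s≤s ())
keptPos-bounds (x ∷ xs) (true ∷ bs) zero _ = s≤s z≤n , s≤s z≤n
keptPos-bounds (x ∷ xs) (true ∷ bs) (suc r) (s≤s h)
  rewrite nth-map-suc (keptPos xs bs) r (subst (r <_) (length-map suc (keptPos xs bs)) h) =
  s≤s z≤n , s≤s (proj₂ (keptPos-bounds xs bs r (subst (r <_) (length-map suc (keptPos xs bs)) h)))
keptPos-bounds (x ∷ xs) (false ∷ bs) r h
  rewrite nth-map-suc (keptPos xs bs) r (subst (r <_) (length-map suc (keptPos xs bs)) h) =
  s≤s z≤n , s≤s (proj₂ (keptPos-bounds xs bs r (subst (r <_) (length-map suc (keptPos xs bs)) h)))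

map-suc-increasing : ∀ L r → suc r < length L → nth 0 L r < nth 0 L (suc r) →
                     nth 0 (map suc L) r < nth 0 (map suc L) (suc r)
map-suc-increasing L r h lt =
  subst₂ _<_ (sym (nth-map-suc L r (<-trans (n<1+n r) h))) (sym (nth-map-suc L (suc r) h)) (s≤s lt)

keptPos-increasing : ∀ {A : Set} (xs : List A) bs r → suc r < length (keptPos xs bs) →
                     nth 0 (keptPos xs bs) r < nth 0 (keptPos xs bs) (suc r)
keptPos-increasing [] [] r (s≤s ())
keptPos-increasing (x ∷ xs) (true ∷ bs) zero (s≤s h)
  rewrite nth-map-suc (keptPos xs bs) 0 (subst (0 <_) (length-map suc (keptPos xs bs)) h) =
  s≤s (proj₁ (keptPos-bounds xs bs 0 (subst (0 <_) (length-map suc (keptPos xs bs)) h)))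
keptPos-increasing (x ∷ xs) (true ∷ bs) (suc r) (s≤s h) =
  map-suc-increasing (keptPos xs bs) r h' (keptPos-increasing xs bs r h')
  where
  h' : suc r < length (keptPos xs bs)
  h' = subst (suc r <_) (length-map suc (keptPos xs bs)) h
keptPos-increasing (x ∷ xs) (false ∷ bs) r h =
  map-suc-increasing (keptPos xs bs) r h' (keptPos-increasing xs bs r h')
  where
  h' : suc r < length (keptPos xs bs)
  h' = subst (suc r <_) (length-map suc (keptPos xs bs)) h

keptPos-last : ∀ {A : Set} (xs : List A) bs → nth 0 (keptPos xs bs) (length (select xs bs)) ≡ suc (length xs)
keptPos-last [] [] = refl
keptPos-last (x ∷ xs) (true ∷ bs) =
  trans (nth-map-suc (keptPos xs bs) _ (subst (length (select xs bs) <_) (sym (keptPos-length xs bs)) ≤-refl)) (cong suc (keptPos-last xs bs))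
keptPos-last (x ∷ xs) (false ∷ bs) =
  trans (nth-map-suc (keptPos xs bs) _ (subst (length (select xs bs) <_) (sym (keptPos-length xs bs)) ≤-refl)) (cong suc (keptPos-last xs bs))

keptPos-kept : ∀ {A : Set} (xs : List A) bs (j : Fin (length xs)) → lookup bs j ≡ true →
               ∃ λ r → r < length (select xs bs) × nth 0 (keptPos xs bs) r ≡ suc (toℕ j)
keptPos-kept (x ∷ xs) (true ∷ bs) F.zero _ = 0 , s≤s z≤n , refl
keptPos-kept (x ∷ xs) (false ∷ bs) F.zero ()
keptPos-kept (x ∷ xs) (true ∷ bs) (F.suc j) kept with keptPos-kept xs bs j kept
... | r , r< , eq = suc r , s≤s r< ,
      trans (nth-map-suc (keptPos xs bs) r (subst (r <_) (sym (keptPos-length xs bs)) (m<n⇒m<1+n r<))) (cong suc eq)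
keptPos-kept (x ∷ xs) (false ∷ bs) (F.suc j) kept with keptPos-kept xs bs j kept
... | r , r< , eq = r , r< ,
      trans (nth-map-suc (keptPos xs bs) r (subst (r <_) (sym (keptPos-length xs bs)) (m<n⇒m<1+n r<))) (cong suc eq)

stepwise-mono : ∀ (τ : ℕ → ℕ) x L → (∀ z → x ≤ z → z < x + L → τ z ≤ τ (suc z)) → τ x ≤ τ (x + L)
stepwise-mono τ x zero h rewrite +-identityʳ x = ≤-refl
stepwise-mono τ x (suc L) h = subst (λ y → τ x ≤ τ y) (sym (+-suc x L))
  (≤-trans (h x ≤-refl (subst (x <_) (sym (+-suc x L)) (s≤s (m≤m+n x L))))
           (stepwise-mono τ (suc x) L (λ z le lt → h z (≤-trans (n≤1+n x) le) (subst (z <_) (sym (+-suc x L)) lt))))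

∸-telescope : ∀ a b c → a ≤ b → b ≤ c → (b ∸ a) + (c ∸ b) ≡ c ∸ a
∸-telescope a b c a≤b b≤c with m≤n⇒∃[o]m+o≡n a≤b | m≤n⇒∃[o]m+o≡n b≤c
... | e1 , refl | e2 , refl
  rewrite m+n∸m≡n a e1 | m+n∸m≡n (a + e1) e2 | +-assoc a e1 e2 | m+n∸m≡n a (e1 + e2) = refl

+-swapʳ : ∀ a b c → a + b + c ≡ a + c + b
+-swapʳ = solve-∀

periodic-induction : ∀ (P : ℕ → Set) k0 → (∀ x → x < suc k0 → P x) → (∀ x → P x → P (x + suc k0)) → ∀ x → P x
periodic-induction P k0 base step x = go (suc x) x ≤-refl
  where
  go : ∀ N x → x < N → P x
  go (suc N) x x<N with x <? suc k0
  ... | yes x<K = base x x<K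
  ... | no x≮K with m≤n⇒∃[o]m+o≡n (≮⇒≥ x≮K)
  ...   | y , refl = subst P (+-comm y (suc k0)) (step y (go N y (≤-trans (s≤s (m≤n+m y k0)) (≤-pred x<N))))

x≤x+y : ∀ x y → 0ℚ ≤q y → x ≤q x +q y
x≤x+y x y 0≤y = subst (_≤q x +q y) (ℚP.+-identityʳ x) (ℚP.+-monoʳ-≤ x 0≤y)

x≤y+x : ∀ x y → 0ℚ ≤q y → x ≤q y +q x
x≤y+x x y 0≤y = subst (x ≤q_) (ℚP.+-comm x y) (x≤x+y x y 0≤y)

module Costs {n : ℕ} (c : Cost n) (tt : IsTravelTime c) where
  open IsTravelTime tt

  cost : (ℕ → Fin n) → ℕ → ℕ → ℚ
  cost f i zero = 0ℚ
  cost f i (suc m) = c (f i) (f (suc i)) +q cost f (suc i) m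

  c-nonneg : ∀ u v → 0ℚ ≤q c u v
  c-nonneg u v with u F.≟ v
  ... | yes refl = ℚP.≤-reflexive (sym (zero-diag u))
  ... | no u≢v = ℚP.<⇒≤ (positive u v u≢v)

  cost-nonneg : ∀ f i m → 0ℚ ≤q cost f i m
  cost-nonneg f i zero = ℚP.≤-refl
  cost-nonneg f i (suc m) =
    subst (_≤q cost f i (suc m)) (ℚP.+-identityˡ 0ℚ) (ℚP.+-mono-≤ (c-nonneg _ _) (cost-nonneg f (suc i) m))

  cost-split : ∀ f i m1 m2 → cost f i (m1 + m2) ≡ cost f i m1 +q cost f (i + m1) m2
  cost-split f i zero m2 rewrite +-identityʳ i = sym (ℚP.+-identityˡ _)
  cost-split f i (suc m1) m2 rewrite +-suc i m1 =
    trans (cong (c (f i) (f (suc i)) +q_) (cost-split f (suc i) m1 m2))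
          (sym (ℚP.+-assoc (c (f i) (f (suc i))) (cost f (suc i) m1) (cost f (suc (i + m1)) m2)))

  cost-cong : ∀ f g i j m → (∀ l → l ≤ m → f (i + l) ≡ g (j + l)) → cost f i m ≡ cost g j m
  cost-cong f g i j zero h = refl
  cost-cong f g i j (suc m) h = cong₂ _+q_ (cong₂ c first second) (cost-cong f g (suc i) (suc j) m h')
    where
    h' : ∀ l → l ≤ m → f (suc i + l) ≡ g (suc j + l)
    h' l le = subst₂ (λ x y → f x ≡ g y) (+-suc i l) (+-suc j l) (h (suc l) (s≤s le))
    first : f i ≡ g j
    first = subst₂ (λ x y → f x ≡ g y) (+-identityʳ i) (+-identityʳ j) (h 0 z≤n)
    second : f (suc i) ≡ g (suc j)
    second = subst₂ (λ x y → f x ≡ g y) (+-identityʳ (suc i)) (+-identityʳ (suc j)) (h' 0 z≤n)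

  cost-mono : ∀ f i m1 m2 → m1 ≤ m2 → cost f i m1 ≤q cost f i m2
  cost-mono f i m1 m2 m1≤m2 with m≤n⇒∃[o]m+o≡n m1≤m2
  ... | e , refl rewrite cost-split f i m1 e = x≤x+y _ _ (cost-nonneg f (i + m1) e)

  cost-window : ∀ f i L i' L' → i' ≤ i → i + L ≤ i' + L' → cost f i L ≤q cost f i' L'
  cost-window f i L i' L' i'≤i inside with m≤n⇒∃[o]m+o≡n i'≤i
  ... | e , refl = begin
    cost f (i' + e) L              ≤⟨ x≤y+x _ _ (cost-nonneg f i' e) ⟩
    cost f i' e +q cost f (i' + e) L ≡⟨ sym (cost-split f i' e L) ⟩
    cost f i' (e + L)              ≤⟨ cost-mono f i' (e + L) L' (+-cancelˡ-≤ i' _ _ (subst (_≤ i' + L') (+-assoc i' e L) inside)) ⟩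
    cost f i' L'                   ∎
    where open ℚP.≤-Reasoning

  c≤cost : ∀ f i m → c (f i) (f (i + m)) ≤q cost f i m
  c≤cost f i zero rewrite +-identityʳ i | zero-diag (f i) = ℚP.≤-refl
  c≤cost f i (suc m) rewrite +-suc i m =
    ℚP.≤-trans (triangle (f i) (f (suc i)) (f (suc (i + m)))) (ℚP.+-monoʳ-≤ (c (f i) (f (suc i))) (c≤cost f (suc i) m))

  cost-pos : ∀ f i m → f i ≢ f (suc i) → 0ℚ <q cost f i (suc m)
  cost-pos f i m ≢next =
    subst (_<q cost f i (suc m)) (ℚP.+-identityʳ 0ℚ) (ℚP.+-mono-<-≤ (positive _ _ ≢next) (cost-nonneg f (suc i) m))

  cost-periodic : ∀ f K → (∀ x → f (x + K) ≡ f x) → ∀ i m → cost f (i + K) m ≡ cost f i m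
  cost-periodic f K per i m = cost-cong f f (i + K) i m (λ l _ → trans (cong f (+-swapʳ i K l)) (per (i + l)))

  shortcut : ∀ f (τ : ℕ → ℕ) x L → (∀ z → x ≤ z → z < x + L → τ z ≤ τ (suc z)) →
             cost (λ z → f (τ z)) x L ≤q cost f (τ x) (τ (x + L) ∸ τ x)
  shortcut f τ x zero h = cost-nonneg f (τ x) (τ (x + zero) ∸ τ x)
  shortcut f τ x (suc L) h = ℚP.≤-trans (ℚP.+-mono-≤ firstMove rest) (ℚP.≤-reflexive glue)
    where
    h' : ∀ z → suc x ≤ z → z < suc x + L → τ z ≤ τ (suc z)
    h' z le lt = h z (≤-trans (n≤1+n x) le) (subst (z <_) (sym (+-suc x L)) lt)
    τ01 : τ x ≤ τ (suc x)
    τ01 = h x ≤-refl (subst (x <_) (sym (+-suc x L)) (s≤s (m≤m+n x L)))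
    τ1L : τ (suc x) ≤ τ (suc x + L)
    τ1L = stepwise-mono τ (suc x) L h'
    firstMove : c (f (τ x)) (f (τ (suc x))) ≤q cost f (τ x) (τ (suc x) ∸ τ x)
    firstMove = subst (λ y → c (f (τ x)) (f y) ≤q cost f (τ x) (τ (suc x) ∸ τ x)) (m+[n∸m]≡n τ01)
                      (c≤cost f (τ x) (τ (suc x) ∸ τ x))
    rest : cost (λ z → f (τ z)) (suc x) L ≤q cost f (τ (suc x)) (τ (suc x + L) ∸ τ (suc x))
    rest = shortcut f τ (suc x) L h'
    glue : cost f (τ x) (τ (suc x) ∸ τ x) +q cost f (τ (suc x)) (τ (suc x + L) ∸ τ (suc x))
           ≡ cost f (τ x) (τ (x + suc L) ∸ τ x)
    glue = begin
      cost f (τ x) (τ (suc x) ∸ τ x) +q cost f (τ (suc x)) (τ (suc x + L) ∸ τ (suc x))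
        ≡⟨ cong (λ y → cost f (τ x) (τ (suc x) ∸ τ x) +q cost f y (τ (suc x + L) ∸ τ (suc x))) (sym (m+[n∸m]≡n τ01)) ⟩
      cost f (τ x) (τ (suc x) ∸ τ x) +q cost f (τ x + (τ (suc x) ∸ τ x)) (τ (suc x + L) ∸ τ (suc x))
        ≡⟨ sym (cost-split f (τ x) (τ (suc x) ∸ τ x) (τ (suc x + L) ∸ τ (suc x))) ⟩
      cost f (τ x) ((τ (suc x) ∸ τ x) + (τ (suc x + L) ∸ τ (suc x)))
        ≡⟨ cong (cost f (τ x)) (∸-telescope _ _ _ τ01 τ1L) ⟩
      cost f (τ x) (τ (suc x + L) ∸ τ x)
        ≡⟨ cong (λ y → cost f (τ x) (τ y ∸ τ x)) (sym (+-suc x L)) ⟩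
      cost f (τ x) (τ (x + suc L) ∸ τ x) ∎
      where open ≡-Reasoning

  pathCost≡cost : ∀ z x xs → pathCost c (x ∷ xs) ≡ cost (nth z (x ∷ xs)) 0 (length xs)
  pathCost≡cost z x [] = refl
  pathCost≡cost z x (y ∷ ys) =
    cong (c x y +q_) (trans (pathCost≡cost z y ys) (cost-cong _ _ 0 1 (length ys) (λ l _ → refl)))

Return : {n : ℕ} → (ℕ → Fin n) → Fin n → ℕ → ℕ → Set
Return f u i j = i < j × f i ≡ u × f j ≡ u × (∀ l → i < l → l < j → f l ≢ u)

return-first : ∀ {n} (f : ℕ → Fin n) {u i j} → Return f u i j → ∀ l → i < l → f l ≡ u → j ≤ l
return-first f {u} {i} {j} (_ , _ , _ , avoids) l i<l fl with l <? j
... | yes l<j = ⊥-elim (avoids l i<l l<j fl)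
... | no l≮j = ≮⇒≥ l≮j

return-unique : ∀ {n} (f : ℕ → Fin n) {u i j j'} → Return f u i j → Return f u i j' → j ≡ j'
return-unique f r r' = ≤-antisym (return-first f r _ (proj₁ r') (proj₁ (proj₂ (proj₂ r'))))
                                 (return-first f r' _ (proj₁ r) (proj₁ (proj₂ (proj₂ r))))

module PeriodicReturns {n : ℕ} (c : Cost n) (tt : IsTravelTime c) (f : ℕ → Fin n) (k0 : ℕ)
                       (per : ∀ x → f (x + suc k0) ≡ f x) where
  open Costs c tt

  K : ℕ
  K = suc k0

  -- firstFrom u x N is the first position in x .. x + N where u occurs (x + N if none).
  firstFrom : Fin n → ℕ → ℕ → ℕ
  firstFrom u x zero = x
  firstFrom u x (suc N) with f x F.≟ u
  ... | yes _ = x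
  ... | no _ = firstFrom u (suc x) N

  firstFrom-spec : ∀ u x N → f (x + N) ≡ u →
    f (firstFrom u x N) ≡ u × x ≤ firstFrom u x N × firstFrom u x N ≤ x + N ×
    (∀ l → x ≤ l → l < firstFrom u x N → f l ≢ u)
  firstFrom-spec u x zero fu =
    subst (λ y → f y ≡ u) (+-identityʳ x) fu , ≤-refl , m≤m+n x 0 , λ l x≤l l<x → ⊥-elim (<⇒≱ l<x x≤l)
  firstFrom-spec u x (suc N) fu with f x F.≟ u
  ... | yes fx = fx , ≤-refl , m≤m+n x (suc N) , λ l x≤l l<x → ⊥-elim (<⇒≱ l<x x≤l)
  ... | no fx≢u with firstFrom-spec u (suc x) N (subst (λ y → f y ≡ u) (+-suc x N) fu)
  ...   | found , from , upto , before =
          found , ≤-trans (n≤1+n x) from , subst (firstFrom u (suc x) N ≤_) (sym (+-suc x N)) upto , before'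
    where
    before' : ∀ l → x ≤ l → l < firstFrom u (suc x) N → f l ≢ u
    before' l x≤l l<found with m≤n⇒m<n∨m≡n x≤l
    ... | inj₁ x<l = before l x<l l<found
    ... | inj₂ refl = fx≢u

  -- next i: the next occurrence of f i after i; it exists within one period.
  next : ℕ → ℕ
  next i = firstFrom (f i) (suc i) k0

  next-return : ∀ i → Return f (f i) i (next i)
  next-return i with firstFrom-spec (f i) (suc i) k0 (trans (cong f (sym (+-suc i k0))) (per i))
  ... | found , from , _ , before = from , refl , found , λ l i<l l<j → before l i<l l<j

  next≤ : ∀ i → next i ≤ i + K
  next≤ i with firstFrom-spec (f i) (suc i) k0 (trans (cong f (sym (+-suc i k0))) (per i))
  ... | _ , _ , upto , _ = subst (next i ≤_) (sym (+-suc i k0)) upto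

  crossing : ∀ u i0 A → f i0 ≡ u → i0 < A → ∃₂ λ i j → Return f u i j × i < A × A ≤ j
  crossing u i0 A fi0 i0<A = go A i0 fi0 i0<A (m≤n+m A i0)
    where
    go : ∀ N i → f i ≡ u → i < A → A ≤ i + N → ∃₂ λ i j → Return f u i j × i < A × A ≤ j
    go zero i fi i<A A≤ = ⊥-elim (<⇒≱ i<A (subst (A ≤_) (+-identityʳ i) A≤))
    go (suc N) i fi i<A A≤ with next i <? A
    ... | yes j<A = go N (next i) (trans (proj₁ (proj₂ (proj₂ (next-return i)))) fi) j<A
                       (≤-trans A≤ (subst (_≤ next i + N) (sym (+-suc i N)) (+-monoˡ-≤ N (proj₁ (next-return i)))))
    ... | no j≮A = i , next i , subst (λ v → Return f v i (next i)) fi (next-return i) , i<A , ≮⇒≥ j≮A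

  unshift : ∀ {u} i y → Return f u (i + K) (i + K + y) → Return f u i (i + y)
  unshift {u} i y (lt , start , end , avoids) =
    m<m+n i (+-cancelˡ-< (i + K) 0 y (subst (_< i + K + y) (sym (+-identityʳ (i + K))) lt)) ,
    trans (sym (per i)) start ,
    trans (sym (per (i + y))) (subst (λ x → f x ≡ u) (+-swapʳ i K y) end) ,
    λ l i<l l<iy fl → avoids (l + K) (+-monoˡ-< K i<l)
                             (subst (l + K <_) (sym (+-swapʳ i K y)) (+-monoˡ-< K l<iy)) (trans (per l) fl)

  nextCost : ℕ → ℚ
  nextCost i = cost f i (next i ∸ i)

  module MaxReturn (u : Fin n) (i0 : ℕ) (fi0 : f i0 ≡ u) where
    best : ℕ → ℕ
    best zero = i0
    best (suc N) with f N F.≟ u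
    ... | no _ = best N
    ... | yes _ with nextCost (best N) ≤q? nextCost N
    ...   | yes _ = N
    ...   | no _ = best N

    best-spec : ∀ N → f (best N) ≡ u × (∀ i → i < N → f i ≡ u → nextCost i ≤q nextCost (best N))
    best-spec zero = fi0 , λ i ()
    best-spec (suc N) with f N F.≟ u
    ... | no fN≢u = proj₁ (best-spec N) , λ i i<1+N fi → [ (λ i<N → proj₂ (best-spec N) i i<N fi) ,
                                                           (λ { refl → ⊥-elim (fN≢u fi) }) ]′ (m<1+n⇒m<n∨m≡n i<1+N)
    ... | yes fN with nextCost (best N) ≤q? nextCost N
    ...   | yes le = fN , λ i i<1+N fi → [ (λ i<N → ℚP.≤-trans (proj₂ (best-spec N) i i<N fi) le) ,
                                           (λ { refl → ℚP.≤-refl }) ]′ (m<1+n⇒m<n∨m≡n i<1+N)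
    ...   | no gt = proj₁ (best-spec N) , λ i i<1+N fi → [ (λ i<N → proj₂ (best-spec N) i i<N fi) ,
                                                         (λ { refl → ℚP.<⇒≤ (ℚP.≰⇒> gt) }) ]′ (m<1+n⇒m<n∨m≡n i<1+N)

    RT : ℚ
    RT = nextCost (best K)

    RT-attained : ∃₂ λ i j → Return f u i j × cost f i (j ∸ i) ≡ RT
    RT-attained = best K , next (best K) ,
                  subst (λ v → Return f v (best K) (next (best K))) (proj₁ (best-spec K)) (next-return (best K)) , refl

    -- Every return pair of u costs at most RT: by periodicity it suffices to look at
    -- starts in the first period, where the return pair is the one ending at next i.
    RT-bound : ∀ i j → Return f u i j → cost f i (j ∸ i) ≤q RT
    RT-bound = periodic-induction Bounded k0 firstPeriod shift
      where
      Bounded : ℕ → Set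
      Bounded i = ∀ j → Return f u i j → cost f i (j ∸ i) ≤q RT
      firstPeriod : ∀ i → i < K → Bounded i
      firstPeriod i i<K j r = subst (λ y → cost f i (y ∸ i) ≤q RT) (return-unique f r' r)
                                    (proj₂ (best-spec K) i i<K (proj₁ (proj₂ r)))
        where
        r' : Return f u i (next i)
        r' = subst (λ v → Return f v i (next i)) (proj₁ (proj₂ r)) (next-return i)
      shift : ∀ i → Bounded i → Bounded (i + K)
      shift i ih j r with m≤n⇒∃[o]m+o≡n (<⇒≤ (proj₁ r))
      ... | y , refl = subst (_≤q RT) sameCost (ih (i + y) (unshift i y r))
        where
        sameCost : cost f i (i + y ∸ i) ≡ cost f (i + K) (i + K + y ∸ (i + K))
        sameCost rewrite m+n∸m≡n i y | m+n∸m≡n (i + K) y = sym (cost-periodic f K per i y)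

-- The periodic sequence of a closed walk L with length L = k0 + 2 (period k0 + 1).
module WalkSequence {n : ℕ} (c : Cost n) (tt : IsTravelTime c) (L : List (Fin n)) (z : Fin n) (k0 : ℕ)
                    (len : length L ≡ suc (suc k0)) (closed : head L ≡ last L) where
  open Costs c tt

  seq : ℕ → Fin n
  seq x = nth z L (x % suc k0)

  cyc≡seq : ∀ i → cyc L i ≡ just (seq i)
  cyc≡seq i with length L ∸ 1 | cong (_∸ 1) len
  ... | .(suc k0) | refl = at≡nth z L (i % suc k0) (subst (i % suc k0 <_) (sym len) (m<n⇒m<1+n (m%n<n i (suc k0))))

  seq-periodic : ∀ x → seq (x + suc k0) ≡ seq x
  seq-periodic x = cong (nth z L) ([m+n]%n≡m%n x (suc k0))

  seq≡nth : ∀ x → x ≤ suc k0 → seq x ≡ nth z L x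
  seq≡nth x x≤ with m≤n⇒m<n∨m≡n x≤
  ... | inj₁ x< = cong (nth z L) (m<n⇒m%n≡m x<)
  ... | inj₂ refl = trans (cong (nth z L) (n%n≡0 (suc k0))) (firstIsLast L len closed)
    where
    firstIsLast : ∀ L → length L ≡ suc (suc k0) → head L ≡ last L → nth z L 0 ≡ nth z L (suc k0)
    firstIsLast (y ∷ ys) eq cl =
      just-injective (trans cl (trans (last≡nth z y ys) (cong (λ m → just (nth z (y ∷ ys) m)) (suc-injective eq))))

  segCost≡cost : ∀ i m → segCost c L i m ≡ cost seq i m
  segCost≡cost i zero = refl
  segCost≡cost i (suc m) rewrite cyc≡seq i | cyc≡seq (suc i) = cong (c (seq i) (seq (suc i)) +q_) (segCost≡cost (suc i) m)

  seq≡ : ∀ {i u} → cyc L i ≡ just u → seq i ≡ u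
  seq≡ {i} eq = just-injective (trans (sym (cyc≡seq i)) eq)

  cyc≡ : ∀ {i u} → seq i ≡ u → cyc L i ≡ just u
  cyc≡ {i} eq = trans (cyc≡seq i) (cong just eq)

  return→ : ∀ {u i j} → ReturnPair L u i j → Return seq u i j
  return→ (lt , start , end , avoids) = lt , seq≡ start , seq≡ end , λ l i<l l<j eq → avoids l i<l l<j (cyc≡ eq)

  return← : ∀ {u i j} → Return seq u i j → ReturnPair L u i j
  return← (lt , start , end , avoids) = lt , cyc≡ start , cyc≡ end , λ l i<l l<j eq → avoids l i<l l<j (seq≡ eq)

  toRT : ∀ u r → (∃₂ λ i j → Return seq u i j × cost seq i (j ∸ i) ≡ r) →
         (∀ i j → Return seq u i j → cost seq i (j ∸ i) ≤q r) → IsRT c L u r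
  toRT u r (i , j , ret , eq) bound =
    (i , j , return← ret , trans (segCost≡cost i (j ∸ i)) eq) ,
    λ i j ret → subst (_≤q r) (sym (segCost≡cost i (j ∸ i))) (bound i j (return→ ret))

  fromRT : ∀ {u r} → IsRT c L u r → ∃₂ λ i j → Return seq u i j × cost seq i (j ∸ i) ≡ r
  fromRT ((i , j , ret , eq) , _) = i , j , return→ ret , trans (sym (segCost≡cost i (j ∸ i))) eq

  seq-noStay : Linked (λ x y → x ≢ y) L → ∀ x → seq x ≢ seq (suc x)
  seq-noStay linked = periodic-induction (λ x → seq x ≢ seq (suc x)) k0 firstPeriod shift
    where
    firstPeriod : ∀ x → x < suc k0 → seq x ≢ seq (suc x)
    firstPeriod x x< rewrite seq≡nth x (<⇒≤ x<) | seq≡nth (suc x) x< =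
      linked-nth z linked x (subst (suc x <_) (sym len) (s≤s x<))
    shift : ∀ x → seq x ≢ seq (suc x) → seq (x + suc k0) ≢ seq (suc (x + suc k0))
    shift x ne rewrite seq-periodic x = λ eq → ne (trans eq (seq-periodic (suc x)))

module Insertion {n : ℕ} (c : Cost n) (tt : IsTravelTime c)
  (P : List (Fin n)) (d : Fin n) (M Q : List (Fin n))
  (cw : IsClosedWalk (P ++ d ∷ M ++ d ∷ Q)) (d∉M : d ∉ M)
  (binding : IsRevisitTime c (P ++ d ∷ M ++ d ∷ Q) (pathCost c (d ∷ M ++ d ∷ [])))
  (keep : Vec Bool (length M))
  (keepsLast : ∀ (j : Fin (length M)) → Data.List.lookup M j ∉ drop (suc (toℕ j)) M ++ d ∷ [] →
               lookup keep j ≡ true)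
  (D'-noStay : Linked (λ x y → x ≢ y) (d ∷ select M keep ++ d ∷ [])) where

  open Costs c tt
  open Occurrences (F._≟_ {n}) d

  S W W̄ D D' : List (Fin n)
  S = select M keep
  W = P ++ d ∷ M ++ d ∷ Q
  W̄ = P ++ d ∷ M ++ d ∷ S ++ d ∷ Q
  D = d ∷ M ++ d ∷ []
  D' = d ∷ S ++ d ∷ []

  R : ℚ
  R = pathCost c D

  -- D occupies positions p .. b of W and of W̄, and D' occupies b .. b + suc σ of W̄.
  -- W has period K = suc k0 and W̄ has period suc k0'.
  p μ σ q b k0 k0' : ℕ
  p = length P
  μ = length M
  σ = length S
  q = length Q
  b = p + suc μ
  k0 = p + μ + q
  k0' = k0 + suc σ

  lenW : length W ≡ suc (suc k0)
  lenW = trans (length-++ P) (trans (cong (λ x → p + suc x) (length-++ M)) (arith p μ q))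
    where
    arith : ∀ a b c → a + suc (b + suc c) ≡ suc (suc (a + b + c))
    arith = solve-∀

  lenW̄ : length W̄ ≡ suc (suc k0')
  lenW̄ = trans (length-++ P) (trans (cong (λ x → p + suc x) (trans (length-++ M) (cong (λ x → μ + suc x) (length-++ S))))
                                   (arith p μ σ q))
    where
    arith : ∀ a b c e → a + suc (b + suc (c + suc e)) ≡ suc (suc (a + b + e + suc c))
    arith = solve-∀

  movesD : length (M ++ d ∷ []) ≡ suc μ
  movesD = trans (length-++ M) (+-comm μ 1)

  movesD' : length (S ++ d ∷ []) ≡ suc σ
  movesD' = trans (length-++ S) (+-comm σ 1)

  b+q≡K : b + q ≡ suc k0
  b+q≡K = arith p μ q
    where
    arith : ∀ a b c → a + suc b + c ≡ suc (a + b + c)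
    arith = solve-∀

  b≤K : b ≤ suc k0
  b≤K = subst (b ≤_) b+q≡K (m≤m+n b q)

  b+σ+q≡K' : b + suc σ + q ≡ suc k0'
  b+σ+q≡K' = trans (+-swapʳ b (suc σ) q) (cong (_+ suc σ) b+q≡K)

  closedW : head W ≡ last W
  closedW = IsClosedWalk.closed cw

  closedW̄ : head W̄ ≡ last W̄
  closedW̄ = trans (head-++-∷ P d _ _) (trans closedW (trans lastW (sym lastW̄)))
    where
    lastW : last W ≡ last (d ∷ Q)
    lastW = trans (last-++-∷ P d (M ++ d ∷ Q)) (last-++-∷ (d ∷ M) d Q)
    lastW̄ : last W̄ ≡ last (d ∷ Q)
    lastW̄ = trans (last-++-∷ P d (M ++ d ∷ S ++ d ∷ Q)) (trans (last-++-∷ (d ∷ M) d (S ++ d ∷ Q)) (last-++-∷ (d ∷ S) d Q))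

  module SW = WalkSequence c tt W d k0 lenW closedW
  module ST = WalkSequence c tt W̄ d k0' lenW̄ closedW̄

  s t : ℕ → Fin n
  s = SW.seq
  t = ST.seq

  s-D : ∀ y → y ≤ suc μ → s (p + y) ≡ nth d D y
  s-D y y≤ = begin
    s (p + y)                          ≡⟨ SW.seq≡nth (p + y) (≤-trans (+-monoʳ-≤ p y≤) b≤K) ⟩
    nth d W (p + y)                    ≡⟨ nth-++ʳ d P _ y ⟩
    nth d (d ∷ M ++ d ∷ Q) y           ≡⟨ cong (λ L → nth d (d ∷ L) y) (sym (++-assoc M (d ∷ []) Q)) ⟩
    nth d (D ++ Q) y                   ≡⟨ nth-++ˡ d D Q y (s≤s (subst (y ≤_) (sym movesD) y≤)) ⟩
    nth d D y                          ∎
    where open ≡-Reasoning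

  s-M : ∀ e → e < μ → s (p + suc e) ≡ nth d M e
  s-M e e<μ = trans (s-D (suc e) (s≤s (<⇒≤ e<μ))) (nth-++ˡ d M (d ∷ []) e e<μ)

  s-b : s b ≡ d
  s-b = trans (s-D (suc μ) ≤-refl) (subst (λ x → nth d (M ++ d ∷ []) x ≡ d) (+-identityʳ μ) (nth-++ʳ d M (d ∷ []) 0))

  s-p : s p ≡ d
  s-p = trans (cong s (sym (+-identityʳ p))) (s-D 0 z≤n)

  s-M≢d : ∀ e → e < μ → s (p + suc e) ≢ d
  s-M≢d e e<μ eq = d∉M (subst (_∈ M) (trans (sym (s-M e e<μ)) eq) (nth∈ d M e e<μ))

  t-prefix : ∀ x → x ≤ b → t x ≡ s x
  t-prefix x x≤b = begin
    t x                                 ≡⟨ ST.seq≡nth x (≤-trans x≤b (≤-trans b≤K (s≤s (m≤m+n k0 (suc σ))))) ⟩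
    nth d W̄ x                           ≡⟨ cong (λ L → nth d L x) (sym (prefix (S ++ d ∷ Q))) ⟩
    nth d ((P ++ D) ++ S ++ d ∷ Q) x    ≡⟨ nth-++ˡ d (P ++ D) _ x inPrefix ⟩
    nth d (P ++ D) x                    ≡⟨ sym (nth-++ˡ d (P ++ D) Q x inPrefix) ⟩
    nth d ((P ++ D) ++ Q) x             ≡⟨ cong (λ L → nth d L x) (prefix Q) ⟩
    nth d W x                           ≡⟨ sym (SW.seq≡nth x (≤-trans x≤b b≤K)) ⟩
    s x                                 ∎
    where
    open ≡-Reasoning
    prefix : ∀ X → (P ++ D) ++ X ≡ P ++ d ∷ M ++ d ∷ X
    prefix X = trans (++-assoc P D X) (cong (λ Y → P ++ d ∷ Y) (++-assoc M (d ∷ []) X))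
    inPrefix : x < length (P ++ D)
    inPrefix = subst (x <_) (sym (trans (length-++ P) (trans (cong (λ y → p + suc y) movesD) (+-suc p (suc μ))))) (s≤s x≤b)

  t-D' : ∀ z → z ≤ suc σ → t (b + z) ≡ nth d D' z
  t-D' z z≤ = begin
    t (b + z)                                  ≡⟨ ST.seq≡nth (b + z) (+-mono-≤ b≤K z≤) ⟩
    nth d W̄ (b + z)                            ≡⟨ cong (λ L → nth d L (b + z)) split ⟩
    nth d ((P ++ d ∷ M) ++ D' ++ Q) (b + z)    ≡⟨ cong (λ x → nth d ((P ++ d ∷ M) ++ D' ++ Q) (x + z)) (sym (length-++ P)) ⟩
    nth d ((P ++ d ∷ M) ++ D' ++ Q) (length (P ++ d ∷ M) + z) ≡⟨ nth-++ʳ d (P ++ d ∷ M) (D' ++ Q) z ⟩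
    nth d (D' ++ Q) z                          ≡⟨ nth-++ˡ d D' Q z (s≤s (subst (z ≤_) (sym movesD') z≤)) ⟩
    nth d D' z                                 ∎
    where
    open ≡-Reasoning
    split : W̄ ≡ (P ++ d ∷ M) ++ D' ++ Q
    split = trans (cong (λ X → P ++ d ∷ M ++ d ∷ X) (sym (++-assoc S (d ∷ []) Q))) (sym (++-assoc P (d ∷ M) (D' ++ Q)))

  t-suffix₀ : ∀ y → y ≤ q → t (b + suc σ + y) ≡ s (b + y)
  t-suffix₀ y y≤q = begin
    t (b + suc σ + y)                     ≡⟨ ST.seq≡nth _ (subst (b + suc σ + y ≤_) b+σ+q≡K' (+-monoʳ-≤ (b + suc σ) y≤q)) ⟩
    nth d W̄ (b + suc σ + y)               ≡⟨ cong (λ L → nth d L (b + suc σ + y)) W̄-split ⟩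
    nth d (PMS ++ d ∷ Q) (b + suc σ + y)  ≡⟨ cong (λ x → nth d (PMS ++ d ∷ Q) (x + y)) (sym lenPMS) ⟩
    nth d (PMS ++ d ∷ Q) (length PMS + y) ≡⟨ nth-++ʳ d PMS (d ∷ Q) y ⟩
    nth d (d ∷ Q) y                       ≡⟨ sym (nth-++ʳ d (P ++ d ∷ M) (d ∷ Q) y) ⟩
    nth d ((P ++ d ∷ M) ++ d ∷ Q) (length (P ++ d ∷ M) + y) ≡⟨ cong (λ x → nth d ((P ++ d ∷ M) ++ d ∷ Q) (x + y)) (length-++ P) ⟩
    nth d ((P ++ d ∷ M) ++ d ∷ Q) (b + y) ≡⟨ cong (λ L → nth d L (b + y)) (++-assoc P (d ∷ M) (d ∷ Q)) ⟩
    nth d W (b + y)                       ≡⟨ sym (SW.seq≡nth (b + y) (subst (b + y ≤_) b+q≡K (+-monoʳ-≤ b y≤q))) ⟩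
    s (b + y)                             ∎
    where
    open ≡-Reasoning
    PMS : List (Fin n)
    PMS = P ++ d ∷ M ++ d ∷ S
    W̄-split : W̄ ≡ PMS ++ d ∷ Q
    W̄-split = sym (trans (++-assoc P (d ∷ M ++ d ∷ S) (d ∷ Q)) (cong (λ X → P ++ d ∷ X) (++-assoc M (d ∷ S) (d ∷ Q))))
    lenPMS : length PMS ≡ b + suc σ
    lenPMS = trans (length-++ P) (trans (cong (λ x → p + suc x) (length-++ M)) (arith p μ σ))
      where
      arith : ∀ a x y → a + suc (x + suc y) ≡ a + suc x + suc y
      arith = solve-∀

  -- The same holds for a whole period after b, using periodicity beyond Q.
  t-suffix : ∀ y → y ≤ suc k0 → t (b + suc σ + y) ≡ s (b + y)
  t-suffix y y≤ with y ≤? q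
  ... | yes y≤q = t-suffix₀ y y≤q
  ... | no y≰q with m≤n⇒∃[o]m+o≡n (<⇒≤ (≰⇒> y≰q))
  ...   | e , refl = trans (cong t shiftW̄) (trans (ST.seq-periodic e)
                       (trans (t-prefix e e≤b) (trans (sym (SW.seq-periodic e)) (cong s shiftW))))
    where
    e≤b : e ≤ b
    e≤b = +-cancelˡ-≤ q e b (subst (q + e ≤_) (trans (sym b+q≡K) (+-comm b q)) y≤)
    shiftW̄ : b + suc σ + (q + e) ≡ e + suc k0'
    shiftW̄ = trans (sym (+-assoc (b + suc σ) q e)) (trans (cong (_+ e) b+σ+q≡K') (+-comm (suc k0') e))
    shiftW : e + suc k0 ≡ b + (q + e)
    shiftW = trans (+-comm e (suc k0)) (trans (cong (_+ e) (sym b+q≡K)) (+-assoc b q e))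

  -- τ z is the position in D of the z-th entry of D'; it increases from 0 to suc μ.
  τ : ℕ → ℕ
  τ z = nth 0 (0 ∷ keptPos M keep) z

  lenKept : length (keptPos M keep) ≡ suc σ
  lenKept = keptPos-length M keep

  D'≡D∘τ : ∀ z → nth d D' z ≡ nth d D (τ z)
  D'≡D∘τ z = trans (cong (λ L → nth d (d ∷ L) z) (sym (keptPos-select d M keep d)))
                   (nth-map (nth d D) 0 (0 ∷ keptPos M keep) z)

  τ-bound : ∀ z → z ≤ suc σ → τ z ≤ suc μ
  τ-bound zero _ = z≤n
  τ-bound (suc r) (s≤s r≤) = proj₂ (keptPos-bounds M keep r (subst (r <_) (sym lenKept) (s≤s r≤)))

  τ-step : ∀ z → z ≤ σ → τ z < τ (suc z)
  τ-step zero _ = proj₁ (keptPos-bounds M keep 0 (subst (0 <_) (sym lenKept) (s≤s z≤n)))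
  τ-step (suc r) r< = keptPos-increasing M keep r (subst (suc r <_) (sym lenKept) (s≤s r<))

  τ-last : τ (suc σ) ≡ suc μ
  τ-last = keptPos-last M keep

  τ-mono : ∀ x y → x ≤ y → y ≤ suc σ → τ x ≤ τ y
  τ-mono x y x≤y y≤ with m≤n⇒∃[o]m+o≡n x≤y
  ... | L , refl = stepwise-mono τ x L (λ z _ z< → <⇒≤ (τ-step z (≤-pred (≤-trans z< y≤))))

  τ-strict : ∀ x y → x < y → y ≤ suc σ → τ x < τ y
  τ-strict x y x<y y≤ = <-≤-trans (τ-step x (≤-pred (≤-trans x<y y≤))) (τ-mono (suc x) y x<y y≤)

  τ-reflects : ∀ x y → x ≤ suc σ → τ x ≤ τ y → x ≤ y
  τ-reflects x y x≤ τ≤ with y <? x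
  ... | yes y<x = ⊥-elim (<⇒≱ (τ-strict y x y<x x≤) τ≤)
  ... | no y≮x = ≮⇒≥ y≮x

  τ-inner : ∀ r → r < σ → ∃ λ e → e < μ × τ (suc r) ≡ suc e
  τ-inner r r<σ = τ (suc r) ∸ 1 , e<μ , sym pred-suc
    where
    pred-suc : suc (τ (suc r) ∸ 1) ≡ τ (suc r)
    pred-suc = m+[n∸m]≡n (proj₁ (keptPos-bounds M keep r (subst (r <_) (sym lenKept) (s≤s (<⇒≤ r<σ)))))
    e<μ : τ (suc r) ∸ 1 < μ
    e<μ = ≤-pred (subst (λ x → suc x ≤ suc μ) (sym pred-suc)
                        (subst (τ (suc r) <_) τ-last (τ-strict (suc r) (suc σ) (s≤s r<σ) ≤-refl)))

  last⇒kept : ∀ e → e < μ → nth d M e ∉ drop (suc e) M ++ d ∷ [] → ∃ λ r → r < σ × τ (suc r) ≡ suc e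
  last⇒kept e e<μ isLast with keptPos-kept M keep (F.fromℕ< e<μ) (keepsLast (F.fromℕ< e<μ) isLast')
    where
    isLast' : Data.List.lookup M (F.fromℕ< e<μ) ∉ drop (suc (toℕ (F.fromℕ< e<μ))) M ++ d ∷ []
    isLast' rewrite lookup≡nth d M (F.fromℕ< e<μ) | toℕ-fromℕ< e<μ = isLast
  ... | r , r<σ , eq = r , r<σ , trans eq (cong suc (toℕ-fromℕ< e<μ))

  t-τ : ∀ z → z ≤ suc σ → t (b + z) ≡ s (p + τ z)
  t-τ z z≤ = trans (t-D' z z≤) (trans (D'≡D∘τ z) (sym (s-D (τ z) (τ-bound z z≤))))

  t-b : t b ≡ d
  t-b = trans (t-prefix b ≤-refl) s-b

  t-b' : t (b + suc σ) ≡ d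
  t-b' = trans (t-τ (suc σ) ≤-refl) (trans (cong (λ x → s (p + x)) τ-last) s-b)

  sD : ℕ → Fin n
  sD y = s (p + y)

  R≡ : R ≡ cost sD 0 (suc μ)
  R≡ = trans (pathCost≡cost d d (M ++ d ∷ [])) (trans (cong (cost (nth d D) 0) movesD)
             (cost-cong (nth d D) sD 0 0 (suc μ) (λ l l≤ → sym (s-D l l≤))))

  D-cost : cost s p (suc μ) ≡ R
  D-cost = sym (trans R≡ (cost-cong sD s 0 p (suc μ) (λ l _ → refl)))

  D-window : ∀ A L → A + L ≤ suc μ → cost sD A L ≤q R
  D-window A L inside = ℚP.≤-trans (cost-window sD A L 0 (suc μ) z≤n inside) (ℚP.≤-reflexive (sym R≡))

  D'-shortcut : ∀ x L → x + L ≤ suc σ → cost t (b + x) L ≤q cost sD (τ x) (τ (x + L) ∸ τ x)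
  D'-shortcut x L inside =
    ℚP.≤-trans (ℚP.≤-reflexive (cost-cong t (λ z → sD (τ z)) (b + x) x L
                 (λ l l≤ → trans (cong t (+-assoc b x l)) (t-τ (x + l) (≤-trans (+-monoʳ-≤ x l≤) inside)))))
               (shortcut sD τ x L (λ z _ z< → <⇒≤ (τ-step z (≤-pred (≤-trans z< inside)))))

  D'-shortcut₀ : ∀ L → L ≤ suc σ → cost t b L ≤q cost sD 0 (τ L)
  D'-shortcut₀ L L≤ = subst (λ x → cost t x L ≤q cost sD 0 (τ L)) (+-identityʳ b) (D'-shortcut 0 L L≤)

  prefix-cost : ∀ i L → i + L ≤ b → cost t i L ≡ cost s i L
  prefix-cost i L inside = cost-cong t s i i L (λ l l≤ → t-prefix (i + l) (≤-trans (+-monoʳ-≤ i l≤) inside))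

  module RS = PeriodicReturns c tt s k0 SW.seq-periodic

  s-return≤R : ∀ {u i j} → Return s u i j → cost s i (j ∸ i) ≤q R
  s-return≤R {u} {i} {j} r = ℚP.≤-trans (RT-bound i j r) (proj₂ binding u RT (SW.toRT u RT RT-attained RT-bound))
    where open RS.MaxReturn u i (proj₁ (proj₂ r))

  s-noStay : ∀ x → s x ≢ s (suc x)
  s-noStay = SW.seq-noStay (IsClosedWalk.noStay cw)

  k≡K : IsClosedWalk.k cw ≡ suc k0
  k≡K = suc-injective (trans (sym (IsClosedWalk.len cw)) lenW)

  occurs : ∀ u → ∃ λ e → e < suc k0 × s e ≡ u
  occurs u with ∈take⇒nth d (IsClosedWalk.k cw) W (IsClosedWalk.covers cw u)
  ... | e , e<k , eq = e , e<K , trans (SW.seq≡nth e (<⇒≤ e<K)) eq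
    where
    e<K : e < suc k0
    e<K = subst (e <_) k≡K e<k

  straddle : ∀ i j A → cost s A (suc μ) ≡ R → i < A → A + suc μ ≤ j → R <q cost s i (j ∸ i)
  straddle i j A copy i<A A≤j with m≤n⇒∃[o]m+o≡n i<A | m≤n⇒∃[o]m+o≡n A≤j
  ... | e1 , refl | e2 , refl = begin-strict
    R                                                ≡⟨ sym (ℚP.+-identityˡ R) ⟩
    0ℚ +q R                                          <⟨ ℚP.+-mono-<-≤ (cost-pos s i e1 (s-noStay i)) (ℚP.≤-reflexive (sym copy')) ⟩
    cost s i (suc e1) +q cost s (i + suc e1) (suc μ) ≡⟨ sym (cost-split s i (suc e1) (suc μ)) ⟩
    cost s i (suc e1 + suc μ)                        ≤⟨ cost-mono s i _ _ (subst (suc e1 + suc μ ≤_) (sym len) (m≤m+n _ e2)) ⟩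
    cost s i (suc i + e1 + suc μ + e2 ∸ i)           ∎
    where
    open ℚP.≤-Reasoning
    copy' : cost s (i + suc e1) (suc μ) ≡ R
    copy' = trans (cong (λ x → cost s x (suc μ)) (+-suc i e1)) copy
    arith : ∀ a x y z → suc a + x + suc y + z ≡ a + (suc x + suc y + z)
    arith = solve-∀
    len : suc i + e1 + suc μ + e2 ∸ i ≡ suc e1 + suc μ + e2
    len = trans (cong (_∸ i) (arith i e1 μ e2)) (m+n∸m≡n i _)

  nextCopy : ℕ
  nextCopy = p + suc k0

  nextCopy-cost : cost s nextCopy (suc μ) ≡ R
  nextCopy-cost = trans (cost-periodic s (suc k0) SW.seq-periodic p (suc μ)) D-cost

  inCopy⇒inD : ∀ {u} y → y ≤ suc μ → s (nextCopy + y) ≡ u → u ∈ D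
  inCopy⇒inD {u} y y≤ eq = subst (_∈ D) D-y (nth∈ d D y (s≤s (subst (y ≤_) (sym movesD) y≤)))
    where
    D-y : nth d D y ≡ u
    D-y = trans (sym (s-D y y≤)) (trans (sym (SW.seq-periodic (p + y))) (trans (cong s (+-swapʳ p y (suc k0))) eq))

  open import Data.List.Membership.DecPropositional (F._≟_ {n}) using (_∈?_)

  -- (2) Every target occurs in D: a return pair crossing into the next copy of D
  -- either ends inside it or straddles it, and the latter costs more than R.
  inD : ∀ u → u ∈ D
  inD u with u ∈? D
  ... | yes u∈D = u∈D
  ... | no u∉D with occurs u
  ...   | i0 , i0<K , si0 with RS.crossing u i0 nextCopy si0 (≤-trans i0<K (m≤n+m (suc k0) p))
  ...     | i , j , r , i<A , A≤j with j ≤? nextCopy + suc μ | m≤n⇒∃[o]m+o≡n A≤j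
  ...       | yes j≤ | y , refl =
              ⊥-elim (u∉D (inCopy⇒inD y (+-cancelˡ-≤ nextCopy y (suc μ) j≤) (proj₁ (proj₂ (proj₂ r)))))
  ...       | no j≰ | _ =
              ⊥-elim (ℚP.<-irrefl refl (ℚP.<-≤-trans (straddle i j nextCopy nextCopy-cost i<A (<⇒≤ (≰⇒> j≰))) (s-return≤R r)))

  inD-position : ∀ u → ∃ λ y → y ≤ μ × s (p + suc y) ≡ u
  inD-position u with inD u
  ... | here refl = μ , ≤-refl , s-b
  ... | there u∈ with ∈⇒nth d (M ++ d ∷ []) u∈
  ...   | e , e< , eq = e , e≤μ , trans (s-D (suc e) (s≤s e≤μ)) eq
    where
    e≤μ : e ≤ μ
    e≤μ = ≤-pred (subst (e <_) movesD e<)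

  Covered : ℕ → Set
  Covered i = ∃ λ w → i < w × t w ≡ t i × cost t i (w ∸ i) ≤q R

  IsLast : ℕ → Set
  IsLast e = nth d M e ∉ drop (suc e) M ++ d ∷ []

  exit⇒last : ∀ e j → e < μ → Return s (s (p + suc e)) (p + suc e) j → b < j → IsLast e
  exit⇒last e j e<μ (_ , _ , _ , avoids) b<j later with ∈after⇒nth M e d e<μ later
  ... | y , e<y , y≤μ , eq = avoids (p + suc y) (+-monoʳ-< p (s≤s e<y)) (≤-<-trans (+-monoʳ-≤ p (s≤s y≤μ)) b<j)
                                    (trans (trans (s-D (suc y) (s≤s y≤μ)) eq) (sym (s-M e e<μ)))

  last⇒noRepeat : ∀ e → e < μ → IsLast e → ∀ l → p + suc e < l → l ≤ b → s l ≢ nth d M e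
  last⇒noRepeat e e<μ isLast l e<l l≤b eq with m≤n⇒∃[o]m+o≡n e<l
  ... | y0 , refl = isLast (subst (_∈ drop (suc e) M ++ d ∷ []) same (nth∈after M e (suc e + y0) d (m≤m+n (suc e) y0) y≤μ))
    where
    arith : ∀ a x y → suc (a + suc x) + y ≡ a + suc (suc x + y)
    arith = solve-∀
    y≤μ : suc e + y0 ≤ μ
    y≤μ = ≤-pred (+-cancelˡ-≤ p _ _ (subst (_≤ b) (arith p e y0) l≤b))
    same : nth d (M ++ d ∷ []) (suc e + y0) ≡ nth d M e
    same = trans (sym (s-D (suc (suc e + y0)) (s≤s y≤μ))) (trans (cong s (sym (arith p e y0))) eq)

  insideD : ∀ i → p < i → i < b → ∃ λ e → e < μ × i ≡ p + suc e
  insideD i p<i i<b with m≤n⇒∃[o]m+o≡n p<i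
  ... | e , refl = e , ≤-pred (+-cancelˡ-< p (suc e) (suc μ) (subst (_< b) (sym (+-suc p e)) i<b)) , sym (+-suc p e)

  t-inner : ∀ r e → r < σ → e < μ → τ (suc r) ≡ suc e → t (b + suc r) ≡ nth d M e
  t-inner r e r<σ e<μ τr = trans (t-τ (suc r) (s≤s (<⇒≤ r<σ))) (trans (cong (λ x → s (p + x)) τr) (s-M e e<μ))

  -- From the end of D, the walk D' leads back to d at cost at most that of D.
  covered-b : Covered b
  covered-b = b + suc σ , m<m+n b (s≤s z≤n) , trans t-b' (sym t-b) ,
    subst (_≤q R) (cong (cost t b) (sym (m+n∸m≡n b (suc σ))))
      (ℚP.≤-trans (D'-shortcut₀ (suc σ) ≤-refl) (ℚP.≤-reflexive (trans (cong (cost sD 0) τ-last) (sym R≡))))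

  -- A last occurrence in M is covered by its copy in D': the rest of D plus the start
  -- of D' up to that copy costs at most the rest of D plus the start of D up to it.
  covered-last-M : ∀ e → e < μ → IsLast e → Covered (p + suc e)
  covered-last-M e e<μ isLast with last⇒kept e e<μ isLast
  ... | r , r<σ , τr = b + suc r , ≤-trans i<b (m≤m+n b (suc r)) , t-eq , costBound
    where
    g : ℕ
    g = μ ∸ e
    e+g : suc e + g ≡ suc μ
    e+g = cong suc (m+[n∸m]≡n (<⇒≤ e<μ))
    i+g : p + suc e + g ≡ b
    i+g = trans (+-assoc p (suc e) g) (cong (p +_) e+g)
    i<b : p + suc e < b
    i<b = +-monoʳ-< p (s≤s e<μ)
    t-eq : t (b + suc r) ≡ t (p + suc e)
    t-eq = trans (t-inner r e r<σ e<μ τr) (sym (trans (t-prefix _ (<⇒≤ i<b)) (s-M e e<μ)))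
    len : b + suc r ∸ (p + suc e) ≡ g + suc r
    len = trans (cong (λ x → x + suc r ∸ (p + suc e)) (sym i+g))
                (trans (cong (_∸ (p + suc e)) (+-assoc (p + suc e) g (suc r))) (m+n∸m≡n (p + suc e) (g + suc r)))
    costBound : cost t (p + suc e) (b + suc r ∸ (p + suc e)) ≤q R
    costBound = begin
      cost t (p + suc e) (b + suc r ∸ (p + suc e))            ≡⟨ cong (cost t (p + suc e)) len ⟩
      cost t (p + suc e) (g + suc r)                           ≡⟨ cost-split t (p + suc e) g (suc r) ⟩
      cost t (p + suc e) g +q cost t (p + suc e + g) (suc r)   ≡⟨ cong₂ _+q_ (prefix-cost (p + suc e) g (≤-reflexive i+g))
                                                                            (cong (λ x → cost t x (suc r)) i+g) ⟩
      cost s (p + suc e) g +q cost t b (suc r)                 ≤⟨ ℚP.+-monoʳ-≤ (cost s (p + suc e) g) (D'-shortcut₀ (suc r) (s≤s (<⇒≤ r<σ))) ⟩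
      cost s (p + suc e) g +q cost sD 0 (τ (suc r))            ≡⟨ cong (λ x → cost s (p + suc e) g +q cost sD 0 x) τr ⟩
      cost s (p + suc e) g +q cost sD 0 (suc e)                ≡⟨ cong (cost s (p + suc e) g +q_) (cost-cong sD s 0 p (suc e) (λ l _ → refl)) ⟩
      cost s (p + suc e) g +q cost s p (suc e)                 ≡⟨ ℚP.+-comm (cost s (p + suc e) g) (cost s p (suc e)) ⟩
      cost s p (suc e) +q cost s (p + suc e) g                 ≡⟨ sym (cost-split s p (suc e) g) ⟩
      cost s p (suc e + g)                                     ≡⟨ cong (cost s p) e+g ⟩
      cost s p (suc μ)                                         ≡⟨ D-cost ⟩
      R                                                        ∎
      where open ℚP.≤-Reasoning

  -- A position up to b whose return in s leaves D is covered: it is b itself, or an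
  -- entry of M which is then a last occurrence (earlier positions return within D by (2)).
  covered-exit : ∀ i → i ≤ b → ∀ j → Return s (s i) i j → b < j → Covered i
  covered-exit i i≤b j ret b<j with i ≟ b | p <? i
  ... | yes refl | _ = covered-b
  ... | no i≢b | yes p<i with insideD i p<i (≤∧≢⇒< i≤b i≢b)
  ...   | e , e<μ , refl = covered-last-M e e<μ (exit⇒last e j e<μ ret b<j)
  covered-exit i i≤b j ret b<j | no i≢b | no p≮i with inD-position (s i)
  ... | y , y≤μ , eq = ⊥-elim (<⇒≱ b<j (≤-trans (return-first s ret (p + suc y) i<l eq) (+-monoʳ-≤ p (s≤s y≤μ))))
    where
    i<l : i < p + suc y
    i<l = ≤-<-trans (≮⇒≥ p≮i) (m<m+n p (s≤s z≤n))

  -- (3, up to b) Positions of the common prefix are covered as in W, or by covered-exit.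
  covered-prefix : ∀ i → i ≤ b → Covered i
  covered-prefix i i≤b with RS.next i ≤? b | RS.next-return i
  ... | no j≰b | ret = covered-exit i i≤b (RS.next i) ret (≰⇒> j≰b)
  ... | yes j≤b | ret = RS.next i , proj₁ ret ,
        trans (t-prefix _ j≤b) (trans (proj₁ (proj₂ (proj₂ ret))) (sym (t-prefix i i≤b))) ,
        subst (_≤q R) (sym (prefix-cost i (RS.next i ∸ i) (subst (_≤ b) (sym (m+[n∸m]≡n (<⇒≤ (proj₁ ret)))) j≤b)))
              (s-return≤R ret)

  -- Inside D', an entry repeated later in D' is covered by that repetition: the stretch
  -- of D' in between is dominated by a stretch inside D.
  covered-D'-repeat : ∀ r r0 → r < r0 → r0 < σ → t (b + suc r0) ≡ t (b + suc r) → Covered (b + suc r)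
  covered-D'-repeat r r0 r<r0 r0<σ same = b + suc r0 , +-monoʳ-< b (s≤s r<r0) , same , costBound
    where
    δ : ℕ
    δ = r0 ∸ r
    δ≤ : suc r + δ ≤ suc σ
    δ≤ = subst (_≤ suc σ) (sym (cong suc (m+[n∸m]≡n (<⇒≤ r<r0)))) (s≤s (<⇒≤ r0<σ))
    τδ≤ : τ (suc r) + (τ (suc r + δ) ∸ τ (suc r)) ≤ suc μ
    τδ≤ = subst (_≤ suc μ) (sym (m+[n∸m]≡n (τ-mono (suc r) (suc r + δ) (m≤m+n (suc r) δ) δ≤))) (τ-bound (suc r + δ) δ≤)
    costBound : cost t (b + suc r) (b + suc r0 ∸ (b + suc r)) ≤q R
    costBound = subst (_≤q R) (cong (cost t (b + suc r)) (sym ([m+n]∸[m+o]≡n∸o b (suc r0) (suc r))))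
                      (ℚP.≤-trans (D'-shortcut (suc r) δ δ≤) (D-window (τ (suc r)) _ τδ≤))

  -- From the inner entry r of D' (the entry e of M) to a position y2 after D', W̄ costs at
  -- most what W costs from the entry e of M to y2 after D: along D' this is dominated by
  -- the rest of D, and after D' the walk W̄ repeats W.
  D'-exit-cost : ∀ r e y2 → r < σ → e < μ → τ (suc r) ≡ suc e → y2 ≤ suc k0 →
                 cost t (b + suc r) (b + suc σ + y2 ∸ (b + suc r)) ≤q cost s (p + suc e) (b + y2 ∸ (p + suc e))
  D'-exit-cost r e y2 r<σ e<μ τr y2≤K = begin
    cost t (b + suc r) (b + suc σ + y2 ∸ (b + suc r))  ≡⟨ cong (cost t (b + suc r)) lenT ⟩
    cost t (b + suc r) (δ + y2)                        ≡⟨ cost-split t (b + suc r) δ y2 ⟩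
    cost t (b + suc r) δ +q cost t (b + suc r + δ) y2  ≤⟨ ℚP.+-mono-≤ alongD' (ℚP.≤-reflexive afterD') ⟩
    cost s l g +q cost s (l + g) y2                    ≡⟨ sym (cost-split s l g y2) ⟩
    cost s l (g + y2)                                  ≡⟨ cong (cost s l) (sym lenS) ⟩
    cost s l (b + y2 ∸ l)                              ∎
    where
    open ℚP.≤-Reasoning
    l g δ : ℕ
    l = p + suc e
    g = μ ∸ e
    δ = σ ∸ r
    rδ : suc r + δ ≡ suc σ
    rδ = cong suc (m+[n∸m]≡n (<⇒≤ r<σ))
    l+g : l + g ≡ b
    l+g = trans (+-assoc p (suc e) g) (cong (p +_) (cong suc (m+[n∸m]≡n (<⇒≤ e<μ))))
    alongD' : cost t (b + suc r) δ ≤q cost s l g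
    alongD' = ℚP.≤-trans (D'-shortcut (suc r) δ (≤-reflexive rδ))
                (ℚP.≤-reflexive (trans (cong₂ (λ x y → cost sD x (y ∸ x)) τr (trans (cong τ rδ) τ-last))
                                       (cost-cong sD s (suc e) l g (λ l' _ → cong s (sym (+-assoc p (suc e) l'))))))
    afterD' : cost t (b + suc r + δ) y2 ≡ cost s (l + g) y2
    afterD' = trans (cong (λ x → cost t x y2) (trans (+-assoc b (suc r) δ) (cong (b +_) rδ)))
                (trans (cost-cong t s (b + suc σ) b y2 (λ l' l'≤ → t-suffix l' (≤-trans l'≤ y2≤K)))
                       (cong (λ x → cost s x y2) (sym l+g)))
    lenT : b + suc σ + y2 ∸ (b + suc r) ≡ δ + y2
    lenT = trans (cong (λ x → b + x + y2 ∸ (b + suc r)) (sym rδ))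
                 (trans (cong (_∸ (b + suc r)) (trans (cong (_+ y2) (sym (+-assoc b (suc r) δ))) (+-assoc (b + suc r) δ y2)))
                        (m+n∸m≡n (b + suc r) (δ + y2)))
    lenS : b + y2 ∸ l ≡ g + y2
    lenS = trans (cong (_∸ l) (trans (cong (_+ y2) (sym l+g)) (+-assoc l g y2))) (m+n∸m≡n l (g + y2))

  -- Inside D', an entry coming from a last occurrence in M is covered via the return of s
  -- from that occurrence, which must leave D and ends within a period.
  covered-D'-last : ∀ r e → r < σ → e < μ → τ (suc r) ≡ suc e → IsLast e →
                    ∀ j → Return s (s (p + suc e)) (p + suc e) j → j ≤ p + suc e + suc k0 → Covered (b + suc r)
  covered-D'-last r e r<σ e<μ τr isLast j ret j≤ with j ≤? b
  ... | yes j≤b = ⊥-elim (last⇒noRepeat e e<μ isLast j (proj₁ ret) j≤b (trans (proj₁ (proj₂ (proj₂ ret))) (s-M e e<μ)))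
  ... | no j≰b with m≤n⇒∃[o]m+o≡n (<⇒≤ (≰⇒> j≰b))
  ...   | y2 , refl = b + suc σ + y2 , ≤-trans (+-monoʳ-< b (s≤s r<σ)) (m≤m+n (b + suc σ) y2) , t-eq ,
                      ℚP.≤-trans (D'-exit-cost r e y2 r<σ e<μ τr y2≤K) (s-return≤R ret)
    where
    y2≤K : y2 ≤ suc k0
    y2≤K = +-cancelˡ-≤ b y2 (suc k0) (≤-trans j≤ (+-monoˡ-≤ (suc k0) (+-monoʳ-≤ p (s≤s (<⇒≤ e<μ)))))
    t-eq : t (b + suc σ + y2) ≡ t (b + suc r)
    t-eq = trans (t-suffix y2 y2≤K) (trans (proj₁ (proj₂ (proj₂ ret))) (trans (s-M e e<μ) (sym (t-inner r e r<σ e<μ τr))))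

  -- The last occurrence p0 of an entry e of M is a last occurrence in M ++ [d], as d ∉ M.
  lastOcc⇒IsLast : ∀ e p0 → e < μ → nth d M p0 ≡ nth d M e → nth d M e ∉ drop (suc p0) M → IsLast p0
  lastOcc⇒IsLast e p0 e<μ same notAfter = subst (_∉ drop (suc p0) M ++ d ∷ []) (sym same)
    (∉-++-[] (drop (suc p0) M) notAfter (λ eq → d∉M (subst (_∈ M) eq (nth∈ d M e e<μ))))

  -- (3, inside D') Let the inner entry r of D' be the entry e of M, and p0 ≥ e the last
  -- occurrence of its target in M; p0 is kept, at some r0 ≥ r.  If r0 > r the repetition
  -- covers r, otherwise e itself is the last occurrence.
  covered-D' : ∀ r → r < σ → Covered (b + suc r)
  covered-D' r r<σ with τ-inner r r<σ
  ... | e , e<μ , τr with lastOcc M e e<μ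
  ...   | p0 , e≤p0 , p0<μ , same , notAfter with last⇒kept p0 p0<μ (lastOcc⇒IsLast e p0 e<μ same notAfter)
  ...     | r0 , r0<σ , τr0 with m≤n⇒m<n∨m≡n (τ-reflects (suc r) (suc r0) (s≤s (<⇒≤ r<σ))
                                                         (subst₂ _≤_ (sym τr) (sym τr0) (s≤s e≤p0)))
  ...       | inj₁ (s≤s r<r0) =
              covered-D'-repeat r r0 r<r0 r0<σ (trans (t-inner r0 p0 r0<σ p0<μ τr0) (trans same (sym (t-inner r e r<σ e<μ τr))))
  ...       | inj₂ refl = covered-D'-last r e r<σ e<μ τr (subst IsLast p0≡e (lastOcc⇒IsLast e p0 e<μ same notAfter))
                            (RS.next (p + suc e)) (RS.next-return (p + suc e)) (RS.next≤ (p + suc e))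
    where
    p0≡e : p0 ≡ e
    p0≡e = suc-injective (trans (sym τr0) τr)

  -- After D', W̄ repeats W after D, so a return of s from there ending within a period
  -- covers the corresponding position of t at the same cost.
  covered-suffix : ∀ y j → Return s (s (b + y)) (b + y) j → j ≤ b + suc k0 → Covered (b + suc σ + y)
  covered-suffix y j ret j≤ with m≤n⇒∃[o]m+o≡n (≤-trans (m≤m+n b y) (<⇒≤ (proj₁ ret)))
  ... | y2 , refl = b + suc σ + y2 , +-monoʳ-< (b + suc σ) y<y2 , t-eq , subst (_≤q R) (sym sameCost) (s-return≤R ret)
    where
    y<y2 : y < y2
    y<y2 = +-cancelˡ-< b y y2 (proj₁ ret)
    y2≤K : y2 ≤ suc k0
    y2≤K = +-cancelˡ-≤ b y2 (suc k0) j≤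
    t-eq : t (b + suc σ + y2) ≡ t (b + suc σ + y)
    t-eq = trans (t-suffix y2 y2≤K) (trans (proj₁ (proj₂ (proj₂ ret))) (sym (t-suffix y (≤-trans (<⇒≤ y<y2) y2≤K))))
    inPeriod : ∀ l → l ≤ y2 ∸ y → y + l ≤ suc k0
    inPeriod l l≤ = ≤-trans (subst (y + l ≤_) (m+[n∸m]≡n (<⇒≤ y<y2)) (+-monoʳ-≤ y l≤)) y2≤K
    sameCost : cost t (b + suc σ + y) (b + suc σ + y2 ∸ (b + suc σ + y)) ≡ cost s (b + y) (b + y2 ∸ (b + y))
    sameCost = begin
      cost t (b + suc σ + y) (b + suc σ + y2 ∸ (b + suc σ + y)) ≡⟨ cong (cost t (b + suc σ + y)) ([m+n]∸[m+o]≡n∸o (b + suc σ) y2 y) ⟩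
      cost t (b + suc σ + y) (y2 ∸ y)                           ≡⟨ cost-cong t s (b + suc σ + y) (b + y) (y2 ∸ y) (λ l l≤ →
                                                                     trans (cong t (+-assoc (b + suc σ) y l))
                                                                           (trans (t-suffix (y + l) (inPeriod l l≤)) (cong s (sym (+-assoc b y l))))) ⟩
      cost s (b + y) (y2 ∸ y)                                   ≡⟨ cong (cost s (b + y)) (sym ([m+n]∸[m+o]≡n∸o b y2 y)) ⟩
      cost s (b + y) (b + y2 ∸ (b + y))                         ∎
      where open ≡-Reasoning

  -- (3, after D') The return of s from b + y ends within a period, since its target
  -- occurs in the next copy of D by (2).
  covered-Q : ∀ y → y < q → Covered (b + suc σ + y)
  covered-Q y y<q with inD-position (s (b + y))
  ... | y' , y'≤μ , eq = covered-suffix y (RS.next (b + y)) ret (≤-trans j≤ (+-monoˡ-≤ (suc k0) (+-monoʳ-≤ p (s≤s y'≤μ))))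
    where
    ret : Return s (s (b + y)) (b + y) (RS.next (b + y))
    ret = RS.next-return (b + y)
    b+y<next : b + y < p + suc y' + suc k0
    b+y<next = <-≤-trans (subst (b + y <_) b+q≡K (+-monoʳ-< b y<q)) (m≤n+m (suc k0) (p + suc y'))
    j≤ : RS.next (b + y) ≤ p + suc y' + suc k0
    j≤ = return-first s ret _ b+y<next (trans (SW.seq-periodic (p + suc y')) eq)

  covered-period : ∀ i → i < suc k0' → Covered i
  covered-period i i<K' with i ≤? b
  ... | yes i≤b = covered-prefix i i≤b
  ... | no i≰b with m≤n⇒∃[o]m+o≡n (≰⇒> i≰b)
  ...   | z , refl with z <? σ
  ...     | yes z<σ = subst Covered (+-suc b z) (covered-D' z z<σ)
  ...     | no z≮σ with m≤n⇒∃[o]m+o≡n (≮⇒≥ z≮σ)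
  ...       | y , refl = subst Covered (arith b σ y) (covered-Q y y<q)
    where
    arith : ∀ a x y → a + suc x + y ≡ suc a + (x + y)
    arith = solve-∀
    y<q : y < q
    y<q = +-cancelˡ-< (b + suc σ) y q (subst₂ _<_ (sym (arith b σ y)) (sym b+σ+q≡K') i<K')

  covered-shift : ∀ i → Covered i → Covered (i + suc k0')
  covered-shift i (w , i<w , tw , costw) =
    w + suc k0' , +-monoˡ-< (suc k0') i<w , trans (ST.seq-periodic w) (trans tw (sym (ST.seq-periodic i))) ,
    subst (_≤q R) sameCost costw
    where
    sameCost : cost t i (w ∸ i) ≡ cost t (i + suc k0') (w + suc k0' ∸ (i + suc k0'))
    sameCost = sym (trans (cong (cost t (i + suc k0')) (trans (cong₂ _∸_ (+-comm w (suc k0')) (+-comm i (suc k0')))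
                                                            ([m+n]∸[m+o]≡n∸o (suc k0') w i)))
                          (cost-periodic t (suc k0') ST.seq-periodic i (w ∸ i)))

  covered : ∀ i → Covered i
  covered = periodic-induction Covered k0' covered-period covered-shift

  -- (4) Every return pair of t ends no later than the covering occurrence, so costs at most R.
  t-return≤R : ∀ {u i j} → Return t u i j → cost t i (j ∸ i) ≤q R
  t-return≤R {u} {i} {j} ret with covered i
  ... | w , i<w , tw , costw = ℚP.≤-trans (cost-mono t i (j ∸ i) (w ∸ i) (∸-monoˡ-≤ i j≤w)) costw
    where
    j≤w : j ≤ w
    j≤w = return-first t ret w i<w (trans tw (proj₁ (proj₂ ret)))

  D-return : Return t d p b
  D-return = m<m+n p (s≤s z≤n) , trans (t-prefix p (m≤m+n p _)) s-p , t-b , avoids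
    where
    avoids : ∀ l → p < l → l < b → t l ≢ d
    avoids l p<l l<b eq with insideD l p<l l<b
    ... | e , e<μ , refl = s-M≢d e e<μ (trans (sym (t-prefix (p + suc e) (<⇒≤ l<b))) eq)

  D-return-cost : cost t p (b ∸ p) ≡ R
  D-return-cost = trans (cong (cost t p) (m+n∸m≡n p (suc μ))) (trans (prefix-cost p (suc μ) ≤-refl) D-cost)

  revisitTime : IsRevisitTime c W̄ R
  revisitTime = (d , ST.toRT d R (p , b , D-return , D-return-cost) (λ i j → t-return≤R)) ,
                λ u r' isRT → bounded (ST.fromRT isRT)
    where
    bounded : ∀ {u r'} → (∃₂ λ i j → Return t u i j × cost t i (j ∸ i) ≡ r') → r' ≤q R
    bounded (i , j , ret , eq) = subst (_≤q R) eq (t-return≤R ret)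

  -- W̄ is a closed walk: D' is glued in at a shared d, and every target already
  -- occurs in the part of W̄ copied from W.
  noStayW̄ : Linked (λ x y → x ≢ y) W̄
  noStayW̄ with linked-split P d (M ++ d ∷ Q) (IsClosedWalk.noStay cw)
  ... | beforeD , fromD with linked-split (d ∷ M) d Q fromD
  ...   | alongD , afterD = linked-join P d _ beforeD (linked-join (d ∷ M) d _ alongD (linked-join (d ∷ S) d Q D'-noStay afterD))

  inFirstPeriod : ∀ i → i < suc k0' → t i ∈ take (suc k0') W̄
  inFirstPeriod i i<K' = subst (_∈ take (suc k0') W̄) (sym (ST.seq≡nth i (<⇒≤ i<K')))
    (nth∈take d W̄ (suc k0') i i<K' (subst (i <_) (sym lenW̄) (<-trans i<K' (n<1+n _))))

  coversW̄ : ∀ u → u ∈ take (suc k0') W̄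
  coversW̄ u with occurs u
  ... | e , e<K , se with e ≤? b
  ...   | yes e≤b = subst (_∈ take (suc k0') W̄) (trans (t-prefix e e≤b) se)
                          (inFirstPeriod e (≤-trans e<K (s≤s (m≤m+n k0 (suc σ)))))
  ...   | no e≰b with m≤n⇒∃[o]m+o≡n (≰⇒> e≰b)
  ...     | y , refl = subst (_∈ take (suc k0') W̄) (trans (t-suffix (suc y) (<⇒≤ y<K)) (trans (cong s (+-suc b y)) se))
                             (inFirstPeriod (b + suc σ + suc y) (subst (b + suc σ + suc y <_) b+σ+q≡K' (+-monoʳ-< (b + suc σ) y<q)))
    where
    y<q : suc y < q
    y<q = +-cancelˡ-< b (suc y) q (subst₂ _<_ (sym (+-suc b y)) (sym b+q≡K) e<K)
    y<K : suc y < suc k0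
    y<K = <-≤-trans y<q (subst (q ≤_) b+q≡K (m≤n+m q b))

  closedWalk : IsClosedWalk W̄
  closedWalk = record
    { k = suc k0' ; len = lenW̄
    ; n≤k = ≤-trans (IsClosedWalk.n≤k cw) (subst (_≤ suc k0') (sym k≡K) (s≤s (m≤m+n k0 (suc σ))))
    ; closed = closedW̄ ; noStay = noStayW̄ ; covers = coversW̄ }

theorem1 : (n : ℕ) → 2 ≤ n → (c : Cost n) → IsTravelTime c →
    (P : List (Fin n)) (d : Fin n) (M Q : List (Fin n)) →
    IsClosedWalk (P ++ d ∷ M ++ d ∷ Q) →
    d ∉ M →
    IsRevisitTime c (P ++ d ∷ M ++ d ∷ Q) (pathCost c (d ∷ M ++ d ∷ [])) →
    (keep : Vec Bool (length M)) →
    (∀ (j : Fin (length M)) → Data.List.lookup M j ∉ drop (suc (toℕ j)) M ++ d ∷ [] →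
        lookup keep j ≡ true) →
    Linked (λ x y → x ≢ y) (d ∷ select M keep ++ d ∷ []) →
    IsClosedWalk (P ++ d ∷ M ++ d ∷ select M keep ++ d ∷ Q) ×
    IsRevisitTime c (P ++ d ∷ M ++ d ∷ select M keep ++ d ∷ Q) (pathCost c (d ∷ M ++ d ∷ []))
theorem1 n _ c tt P d M Q cw d∉M binding keep keepsLast D'-noStay = closedWalk , revisitTime
  where open Insertion c tt P d M Q cw d∉M binding keep keepsLast D'-noStay
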